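{- Let $\Sigma=\{\mathtt{a},\mathtt{b}\}$ and let $k,m\in\mathbb{N}_0$ with $m<k$. Let $N_k^m$ be the number of congruence classes of $\sim_k$ on $\Sigma^*$ that consist of words $w$ with $\iota(w)=m$. Then \[ N_k^m=\left\| \begin{pmatrix} k-m & k-m & k-m\\ 1 & 2 & 1\\ k-m & k-m & k-m\end{pmatrix}^{m}\cdot\begin{pmatrix}k-m\\1\\k-m\end{pmatrix}\right\|_1 = c_k^m, \] where $\|\cdot\|_1$ is the $1$-norm and the numbers $c_j^n$ are defined by $c_j^{ -1}\coloneqq 1$, $c_j^0\coloneqq 2j+1$, and $c_j^n\coloneqq 2(j-n+1)\,c_{j-1}^{n-1}-2(j-n)\,c_{j-2}^{n-2}$ for $n\geq 1$.
   Context: A word $u$ is a scattered factor of $w$ if $u$ is obtained from $w$ by deleting some letters (keeping order). For $k\in\mathbb{N}_0$, $u\sim_k v$ iff $u$ and $v$ have exactly the same scattered factors of length at most $k$ (Simon's congruence). $\iota(w)$ is the largest $\ell$ such that every word of $\Sigma^\ell$ is a scattered factor of $w$ (equivalently, the number of arches in the greedy factorization of $w$ into minimal prefixes containing both letters). If $u\sim_k v$ then either both have $\iota\ge k$ or $\iota(u)=\iota(v)$, so for $m<k$ each class consists either entirely of words with $\iota=m$ or of none. -}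

module Defs where

open import Data.Nat using (ℕ; zero; suc; _≤_; _∸_) renaming (_+_ to _+ℕ_; _*_ to _*ℕ_)
open import Data.Integer using (ℤ; +_) renaming (_+_ to _+ℤ_; _-_ to _-ℤ_; _*_ to _*ℤ_)
open import Data.List using (List; []; _∷_; length)
open import Data.Fin using (Fin)
open import Data.Product using (Σ; _×_; ∃-syntax)
open import Relation.Binary.PropositionalEquality using (_≡_)
open import Function.Bundles using (_⇔_)

data Letter : Set where
  a b : Letter

Word : Set
Word = List Letter

data _≼_ : Word → Word → Set where
  []≼  : ∀ {w} → [] ≼ w
  keep : ∀ {x u w} → u ≼ w → (x ∷ u) ≼ (x ∷ w)
  skip : ∀ {x u w} → u ≼ w → u ≼ (x ∷ w)

_∼[_]_ : Word → ℕ → Word → Set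
u ∼[ k ] v = ∀ (x : Word) → length x ≤ k → ((x ≼ u) ⇔ (x ≼ v))

Universal : ℕ → Word → Set
Universal ℓ w = ∀ (x : Word) → length x ≡ ℓ → x ≼ w

Iota : Word → ℕ → Set
Iota w m = Universal m w × (∀ ℓ → Universal ℓ w → ℓ ≤ m)

ClassCount : ℕ → ℕ → ℕ → Set
ClassCount k m N =
  Σ (Fin N → Word) λ rep →
    (∀ i → Iota (rep i) m)
    × (∀ i j → rep i ∼[ k ] rep j → i ≡ j)
    × (∀ w → Iota w m → ∃[ i ] (w ∼[ k ] rep i))

record Vec3 : Set where
  constructor ⟨_,_,_⟩
  field x₁ x₂ x₃ : ℕ

record Mat3 : Set where
  constructor mat
  field r₁ r₂ r₃ : Vec3

dot : Vec3 → Vec3 → ℕ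
dot ⟨ a₁ , a₂ , a₃ ⟩ ⟨ b₁ , b₂ , b₃ ⟩ = a₁ *ℕ b₁ +ℕ a₂ *ℕ b₂ +ℕ a₃ *ℕ b₃

_·_ : Mat3 → Vec3 → Vec3
mat p q r · v = ⟨ dot p v , dot q v , dot r v ⟩

pow· : Mat3 → ℕ → Vec3 → Vec3
pow· M zero v = v
pow· M (suc n) v = M · pow· M n v

norm1 : Vec3 → ℕ
norm1 ⟨ a₁ , a₂ , a₃ ⟩ = a₁ +ℕ a₂ +ℕ a₃

matrixValue : ℕ → ℕ → ℕ
matrixValue k m = norm1 (pow· (mat ⟨ d , d , d ⟩ ⟨ 1 , 2 , 1 ⟩ ⟨ d , d , d ⟩) m ⟨ d , 1 , d ⟩)
  where d = k ∸ m

-- cShift j n = c_j^{n-1}:  c_j^{-1} = 1, c_j^0 = 2j+1,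
-- c_j^n = 2(j-n+1) c_{j-1}^{n-1} - 2(j-n) c_{j-2}^{n-2}  (n ≥ 1).
-- (Coefficients computed in ℤ; the indices j-1, j-2 are truncated in ℕ,
-- which only matters outside the range j > n relevant here.)
cShift : ℕ → ℕ → ℤ
cShift j zero = + 1
cShift j (suc zero) = + (2 *ℕ j +ℕ 1)
cShift j (suc (suc n)) =
  (+ 2 *ℤ ((+ j -ℤ + (suc n)) +ℤ + 1)) *ℤ cShift (j ∸ 1) (suc n)
  -ℤ (+ 2 *ℤ (+ j -ℤ + (suc n))) *ℤ cShift (j ∸ 2) n

c : ℕ → ℕ → ℤ
c j n = cShift j (suc n)

-- Call a word x-started at level m (StartUniversal x m) if it contains every x t with |t| = m
-- as a scattered factor; a word with ι = m is a-started, b-started or neither ("neutral"),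
-- never both. A word w with ι(w) = m + 1 splits uniquely as w = x^(e+1) x̄ s with ι(s) = m (its
-- first arch), and w is x-started at level m + 1 iff e ≥ 1 or s is x-started, neutral iff e = 0
-- and s is not x-started. For d = k − m ≥ 1 the ∼_(m+1+d)-class of w is determined by x, the
-- ∼_(m+d)-class of s and the exponent e + 1, which matters only up to d if s is x-started and
-- up to d + 1 otherwise. So the numbers (A, N, B) of a-started, neutral and b-started classes
-- evolve by (A, N, B) ↦ (d(A+N+B), A + 2N + B, d(A+N+B)) from (d, 1, d), the classes of a, …, a^d,
-- of ε and of b, …, b^d. As A = B = d·T(m−1) (with T(−1) = 1), the totals satisfy
-- T(m+1) = 2(d+1)T(m) − 2d T(m−1), the recurrence defining c.

module Submission where

open import Defs
open import Data.Nat
  using (ℕ; zero; suc; pred; _+_; _*_; _≤_; _<_; _∸_; z≤n; s≤s; _≤?_; _<?_; _≤′_; ≤′-refl; ≤′-step)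
open import Data.Nat.Properties
  using (≤-trans; ≤-antisym; ≤-reflexive; ≤-pred; n≤1+n; +-suc; +-comm; +-identityʳ;
         m+[n∸m]≡n; m+n∸m≡n; *-identityʳ; ≤⇒≤′; ≤′⇒≤; m≤m+n; ≰⇒>; ≮⇒≥;
         +-monoˡ-≤; +-monoʳ-≤; <-cmp; n≮n)
open import Data.Integer using (+_)
import Data.Integer as Int
open import Data.Integer.Properties using (pos-+; pos-*; [+m]-[+n]≡m⊖n; ⊖-≥)
import Data.Nat.Tactic.RingSolver as ℕ-Solver
import Data.Integer.Tactic.RingSolver as ℤ-Solver
open import Data.List using ([]; _∷_; length; _++_; replicate)
open import Data.List.Properties using (length-++; length-replicate; ++-identityʳ)
open import Data.Product using (_×_; _,_; proj₁; proj₂; ∃-syntax)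
open import Data.Sum using (_⊎_; inj₁; inj₂)
open import Data.Empty using (⊥-elim)
open import Function.Base using (_∘_; id)
open import Relation.Nullary using (¬_; Dec; yes; no)
open import Relation.Binary.Definitions using (DecidableEquality; tri<; tri≈; tri>)
open import Relation.Binary.PropositionalEquality
  using (_≡_; _≢_; refl; sym; trans; cong; cong₂; subst; subst₂; module ≡-Reasoning)
open import Function.Bundles using (mk⇔; Equivalence; _↔_; Inverse)
open import Level using (0ℓ)
open import Relation.Unary using (Pred; _∪_; _∩_; _⊆_; _≐_)
open import Data.Fin using (Fin; toℕ; fromℕ; fromℕ<) renaming (zero to fzero; suc to fsuc)
open import Data.Fin.Properties using (+↔⊎; *↔×; toℕ-injective; toℕ<n; toℕ-fromℕ; toℕ-fromℕ<)
import Function.Properties.Equivalence as ⇔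

other : Letter → Letter
other a = b
other b = a

other-≢ : ∀ x → x ≢ other x
other-≢ a ()
other-≢ b ()

≡-or-≡other : ∀ c x → c ≡ x ⊎ c ≡ other x
≡-or-≡other a a = inj₁ refl
≡-or-≡other a b = inj₂ refl
≡-or-≡other b a = inj₂ refl
≡-or-≡other b b = inj₁ refl

_≟_ : DecidableEquality Letter
a ≟ a = yes refl
a ≟ b = no (λ ())
b ≟ a = no (λ ())
b ≟ b = yes refl

infixl 30 _^_

_^_ : Letter → ℕ → Word
x ^ n = replicate n x

^-++-∷ : ∀ x n w → x ^ n ++ x ∷ w ≡ x ∷ (x ^ n ++ w)
^-++-∷ x zero w = refl
^-++-∷ x (suc n) w = cong (x ∷_) (^-++-∷ x n w)

length-^-++ : ∀ x n w → length (x ^ n ++ w) ≡ n + length w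
length-^-++ x n w = trans (length-++ (x ^ n)) (cong (_+ length w) (length-replicate n))

-- Scattered factors

infix 4 _≼?_

≼-refl : ∀ {w} → w ≼ w
≼-refl {[]} = []≼
≼-refl {x ∷ w} = keep ≼-refl

≼-trans : ∀ {u v w} → u ≼ v → v ≼ w → u ≼ w
≼-trans []≼ q = []≼
≼-trans (keep p) (keep q) = keep (≼-trans p q)
≼-trans (keep p) (skip q) = skip (≼-trans (keep p) q)
≼-trans (skip p) (keep q) = skip (≼-trans p q)
≼-trans (skip p) (skip q) = skip (≼-trans (skip p) q)

≼-length : ∀ {u w} → u ≼ w → length u ≤ length w
≼-length []≼ = z≤n
≼-length (keep p) = s≤s (≼-length p)
≼-length (skip p) = ≤-trans (≼-length p) (n≤1+n _)

≼-++ : ∀ u t → u ≼ (u ++ t)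
≼-++ [] t = []≼
≼-++ (x ∷ u) t = keep (≼-++ u t)

∷≼⇒≼ : ∀ {x u w} → (x ∷ u) ≼ w → u ≼ w
∷≼⇒≼ (keep p) = skip p
∷≼⇒≼ (skip p) = skip (∷≼⇒≼ p)

∷≼∷⁻ : ∀ {x u w} → (x ∷ u) ≼ (x ∷ w) → u ≼ w
∷≼∷⁻ (keep p) = p
∷≼∷⁻ (skip p) = ∷≼⇒≼ p

≢-∷≼∷⁻ : ∀ {x y u w} → x ≢ y → (x ∷ u) ≼ (y ∷ w) → (x ∷ u) ≼ w
≢-∷≼∷⁻ x≢y (keep p) = ⊥-elim (x≢y refl)
≢-∷≼∷⁻ x≢y (skip p) = p

≼-^-++ : ∀ x n {u w} → u ≼ w → u ≼ (x ^ n ++ w)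
≼-^-++ x zero p = p
≼-^-++ x (suc n) p = skip (≼-^-++ x n p)

^-++-≼-mono : ∀ x {i j u w} → i ≤ j → u ≼ w → (x ^ i ++ u) ≼ (x ^ j ++ w)
^-++-≼-mono x {j = j} z≤n p = ≼-^-++ x j p
^-++-≼-mono x (s≤s i≤j) p = keep (^-++-≼-mono x i≤j p)

^-++-≼⁻ : ∀ x n {u w} → (x ^ n ++ u) ≼ (x ^ n ++ w) → u ≼ w
^-++-≼⁻ x zero p = p
^-++-≼⁻ x (suc n) p = ^-++-≼⁻ x n (∷≼∷⁻ p)

≢-∷≼^-++⁻ : ∀ x n {y z w} → y ≢ x → (y ∷ z) ≼ (x ^ n ++ w) → (y ∷ z) ≼ w
≢-∷≼^-++⁻ x zero y≢x p = p
≢-∷≼^-++⁻ x (suc n) y≢x p = ≢-∷≼^-++⁻ x n y≢x (≢-∷≼∷⁻ y≢x p)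

other∷≼^-++-other∷⁻ : ∀ x n {z s} → (other x ∷ z) ≼ (x ^ n ++ other x ∷ s) → z ≼ s
other∷≼^-++-other∷⁻ x n p = ∷≼∷⁻ (≢-∷≼^-++⁻ x n (λ e → other-≢ x (sym e)) p)

_≼?_ : ∀ u w → Dec (u ≼ w)
[] ≼? w = yes []≼
(x ∷ u) ≼? [] = no (λ ())
(x ∷ u) ≼? (y ∷ w) with x ≟ y
... | yes refl with u ≼? w
...   | yes p = yes (keep p)
...   | no ¬p = no (λ q → ¬p (∷≼∷⁻ q))
(x ∷ u) ≼? (y ∷ w) | no x≢y with (x ∷ u) ≼? w
...   | yes p = yes (skip p)
...   | no ¬p = no (λ q → ¬p (≢-∷≼∷⁻ x≢y q))

∀-ofLength? : ∀ n (P : Word → Set) → (∀ t → Dec (P t)) →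
              (∀ t → length t ≡ n → P t) ⊎ (∃[ t ] (length t ≡ n × ¬ P t))
∀-ofLength? zero P P? with P? []
... | yes p = inj₁ (λ { [] refl → p })
... | no ¬p = inj₂ ([] , refl , ¬p)
∀-ofLength? (suc n) P P? with ∀-ofLength? n (λ t → P (a ∷ t)) (λ t → P? (a ∷ t))
                            | ∀-ofLength? n (λ t → P (b ∷ t)) (λ t → P? (b ∷ t))
... | inj₂ (t , l , ¬p) | _ = inj₂ (a ∷ t , cong suc l , ¬p)
... | inj₁ _ | inj₂ (t , l , ¬p) = inj₂ (b ∷ t , cong suc l , ¬p)
... | inj₁ pa | inj₁ pb = inj₁ λ { (a ∷ t) l → pa t (cong pred l)
                                 ; (b ∷ t) l → pb t (cong pred l) }

∼-refl : ∀ {w k} → w ∼[ k ] w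
∼-refl x _ = ⇔.refl

∼-sym : ∀ {u v k} → u ∼[ k ] v → v ∼[ k ] u
∼-sym u∼v x l = ⇔.sym (u∼v x l)

∼-trans : ∀ {u v w k} → u ∼[ k ] v → v ∼[ k ] w → u ∼[ k ] w
∼-trans u∼v v∼w x l = ⇔.trans (u∼v x l) (v∼w x l)

∼⇒≼ : ∀ {u v k x} → u ∼[ k ] v → length x ≤ k → x ≼ u → x ≼ v
∼⇒≼ {x = x} u∼v l = Equivalence.to (u∼v x l)

≼⇔⇒∼ : ∀ {u v k} → (∀ x → length x ≤ k → x ≼ u → x ≼ v) → (∀ x → length x ≤ k → x ≼ v → x ≼ u) → u ∼[ k ] v
≼⇔⇒∼ to from x l = mk⇔ (to x l) (from x l)

≼-padding : ∀ {n z} → length z ≤ n → ∃[ t ] (length t ≡ n × z ≼ t)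
≼-padding {n} {z} l = z ++ a ^ (n ∸ length z) , padded , ≼-++ z _
  where
  padded : length (z ++ a ^ (n ∸ length z)) ≡ n
  padded = trans (length-++ z) (trans (cong (λ k → length z + k) (length-replicate (n ∸ length z))) (m+[n∸m]≡n l))

universal⇒≼ : ∀ {n w z} → Universal n w → length z ≤ n → z ≼ w
universal⇒≼ U l with ≼-padding l
... | t , lt , z≼t = ≼-trans z≼t (U t lt)

universal-anti : ∀ {m n w} → m ≤ n → Universal n w → Universal m w
universal-anti {n = n} m≤n U t l = universal⇒≼ U (subst (_≤ n) (sym l) m≤n)

universal-0 : ∀ w → Universal 0 w
universal-0 w [] refl = []≼

universal-1 : ∀ {w} x → (x ∷ []) ≼ w → (other x ∷ []) ≼ w → Universal 1 w
universal-1 x p q (c ∷ []) refl with ≡-or-≡other c x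
... | inj₁ refl = p
... | inj₂ refl = q

HasIota : ℕ → Word → Set
HasIota m w = Universal m w × ¬ Universal (suc m) w

HasIota⇒Iota : ∀ {m w} → HasIota m w → Iota w m
HasIota⇒Iota {m} {w} (U , ¬U) = U , maximal
  where
  maximal : ∀ ℓ → Universal ℓ w → ℓ ≤ m
  maximal ℓ Uℓ with ℓ ≤? m
  ... | yes ℓ≤m = ℓ≤m
  ... | no ℓ≰m = ⊥-elim (¬U (universal-anti (≰⇒> ℓ≰m) Uℓ))

Iota⇒HasIota : ∀ {m w} → Iota w m → HasIota m w
Iota⇒HasIota {m} (U , maximal) = U , λ U′ → n≮n m (maximal _ U′)

StartUniversal : Letter → ℕ → Word → Set
StartUniversal x n w = ∀ t → length t ≡ n → (x ∷ t) ≼ w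

startUniversal⇒≼ : ∀ {x n w z} → StartUniversal x n w → length z ≤ n → (x ∷ z) ≼ w
startUniversal⇒≼ S l with ≼-padding l
... | t , lt , z≼t = ≼-trans (keep z≼t) (S t lt)

startUniversal? : ∀ x n w → Dec (StartUniversal x n w)
startUniversal? x n w with ∀-ofLength? n (λ t → (x ∷ t) ≼ w) (λ t → (x ∷ t) ≼? w)
... | inj₁ S = yes S
... | inj₂ (t , l , ¬p) = no (λ S → ¬p (S t l))

startUniversal-both⇒universal : ∀ {m w} → StartUniversal a m w → StartUniversal b m w → Universal (suc m) w
startUniversal-both⇒universal Sa Sb (a ∷ t) l = Sa t (cong pred l)
startUniversal-both⇒universal Sa Sb (b ∷ t) l = Sb t (cong pred l)

startUniversal-∼ : ∀ {x m K s s′} → s ∼[ K ] s′ → suc m ≤ K → StartUniversal x m s → StartUniversal x m s′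
startUniversal-∼ {K = K} s∼s′ m<K S t l = ∼⇒≼ s∼s′ (subst (λ n → suc n ≤ K) (sym l) m<K) (S t l)

Neutral : ℕ → Pred Word 0ℓ
Neutral m w = ¬ StartUniversal a m w × ¬ StartUniversal b m w

overStarts : ℕ → (Pred Word 0ℓ → Pred Word 0ℓ) → Pred Word 0ℓ
overStarts m F = (F (StartUniversal a m) ∪ F (Neutral m)) ∪ F (StartUniversal b m)

trichotomy : ∀ m w → overStarts m id w
trichotomy m w with startUniversal? a m w | startUniversal? b m w
... | yes Sa | _       = inj₁ (inj₁ Sa)
... | no ¬Sa | yes Sb  = inj₂ Sb
... | no ¬Sa | no ¬Sb  = inj₁ (inj₂ (¬Sa , ¬Sb))

¬neutral-startUniversal : ∀ {m w} x → Neutral m w → ¬ StartUniversal x m w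
¬neutral-startUniversal a (¬Sa , _) = ¬Sa
¬neutral-startUniversal b (_ , ¬Sb) = ¬Sb

-- Arches

arch : Letter → ℕ → Word → Word
arch x e s = x ^ suc e ++ other x ∷ s

arch-universal : ∀ {n s} x e → Universal n s → Universal (suc n) (arch x e s)
arch-universal x e U (c ∷ t) l with ≡-or-≡other c x
... | inj₁ refl = keep (≼-^-++ x e (skip (U t (cong pred l))))
... | inj₂ refl = skip (≼-^-++ x e (keep (U t (cong pred l))))

^-++-other∷-universal⁻ : ∀ {n s} x e → Universal (suc n) (x ^ e ++ other x ∷ s) → Universal n s
^-++-other∷-universal⁻ x e U t l = other∷≼^-++-other∷⁻ x e (U (other x ∷ t) (cong suc l))

¬other∷≼^ : ∀ x f {z} → ¬ ((other x ∷ z) ≼ x ^ f)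
¬other∷≼^ x (suc f) p = ¬other∷≼^ x f (≢-∷≼∷⁻ (λ e → other-≢ x (sym e)) p)

¬universal-^ : ∀ x f → ¬ Universal 1 (x ^ f)
¬universal-^ x f U = ¬other∷≼^ x f (U (other x ∷ []) refl)

arch-hasIota : ∀ {m s} x e → HasIota m s → HasIota (suc m) (arch x e s)
arch-hasIota x e (U , ¬U) = arch-universal x e U , λ U′ → ¬U (^-++-other∷-universal⁻ x (suc e) U′)

leading-run : ∀ c w → (∃[ f ] w ≡ c ^ f) ⊎ (∃[ f ] ∃[ s ] w ≡ c ^ f ++ other c ∷ s)
leading-run c [] = inj₁ (0 , refl)
leading-run c (d ∷ w) with ≡-or-≡other d c
... | inj₂ refl = inj₂ (0 , w , refl)
... | inj₁ refl with leading-run c w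
...   | inj₁ (f , refl) = inj₁ (suc f , refl)
...   | inj₂ (f , s , refl) = inj₂ (suc f , s , refl)

arch-decomposition : ∀ {m} w → HasIota (suc m) w → ∃[ x ] ∃[ e ] ∃[ s ] (w ≡ arch x e s × HasIota m s)
arch-decomposition [] (U , _) = ⊥-elim (¬universal-^ a 0 (universal-anti (s≤s z≤n) U))
arch-decomposition (c ∷ w) (U , ¬U) with leading-run c w
... | inj₁ (f , refl) = ⊥-elim (¬universal-^ c (suc f) (universal-anti (s≤s z≤n) U))
... | inj₂ (e , s , refl) =
  c , e , s , refl , ^-++-other∷-universal⁻ c (suc e) U , λ U′ → ¬U (arch-universal c e U′)

startUniversal-arch-zero : ∀ {m s} x → Universal m s → StartUniversal x m s → StartUniversal x (suc m) (arch x 0 s)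
startUniversal-arch-zero x U S (c ∷ t) l with ≡-or-≡other c x
... | inj₁ refl = keep (skip (S t (cong pred l)))
... | inj₂ refl = keep (keep (U t (cong pred l)))

startUniversal-arch-suc : ∀ {m s} x e → Universal m s → StartUniversal x (suc m) (arch x (suc e) s)
startUniversal-arch-suc x e U t l = keep (arch-universal x e U t l)

startUniversal-arch-zero⁻ : ∀ {m s} x → StartUniversal x (suc m) (arch x 0 s) → StartUniversal x m s
startUniversal-arch-zero⁻ x S t l = ≢-∷≼∷⁻ (other-≢ x) (∷≼∷⁻ (S (x ∷ t) (cong suc l)))

¬startUniversal-other : ∀ {m s} x e → ¬ Universal (suc m) s → ¬ StartUniversal (other x) (suc m) (x ^ e ++ other x ∷ s)
¬startUniversal-other x e ¬U S = ¬U λ t l → other∷≼^-++-other∷⁻ x e (S t l)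

startUniversal-arch⇒≡ : ∀ {m s} x y e → ¬ Universal (suc m) s → StartUniversal x (suc m) (arch y e s) → y ≡ x
startUniversal-arch⇒≡ a a e ¬U S = refl
startUniversal-arch⇒≡ b b e ¬U S = refl
startUniversal-arch⇒≡ a b e ¬U S = ⊥-elim (¬startUniversal-other b (suc e) ¬U S)
startUniversal-arch⇒≡ b a e ¬U S = ⊥-elim (¬startUniversal-other a (suc e) ¬U S)

startUniversal-arch : ∀ {m s} x e → Universal m s → StartUniversal x m s → StartUniversal x (suc m) (arch x e s)
startUniversal-arch x zero U S = startUniversal-arch-zero x U S
startUniversal-arch x (suc e) U S = startUniversal-arch-suc x e U

neutral-arch : ∀ {m s} x → HasIota m s → ¬ StartUniversal x m s → Neutral (suc m) (arch x 0 s)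
neutral-arch a (_ , ¬U) ¬S = (λ S → ¬S (startUniversal-arch-zero⁻ a S)) , ¬startUniversal-other a 1 ¬U
neutral-arch b (_ , ¬U) ¬S = ¬startUniversal-other b 1 ¬U , (λ S → ¬S (startUniversal-arch-zero⁻ b S))

^-++-∷-≼-∼ : ∀ {K s s′ z} x y e → s ∼[ K ] s′ → length z ≤ K →
             z ≼ (x ^ e ++ y ∷ s) → z ≼ (x ^ e ++ y ∷ s′)
^-++-∷-≼-∼ x y zero s∼s′ l []≼ = []≼
^-++-∷-≼-∼ x y zero s∼s′ l (keep p) = keep (∼⇒≼ s∼s′ (≤-trans (n≤1+n _) l) p)
^-++-∷-≼-∼ x y zero s∼s′ l (skip p) = skip (∼⇒≼ s∼s′ l p)
^-++-∷-≼-∼ x y (suc e) s∼s′ l []≼ = []≼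
^-++-∷-≼-∼ x y (suc e) s∼s′ l (keep p) = keep (^-++-∷-≼-∼ x y e s∼s′ (≤-trans (n≤1+n _) l) p)
^-++-∷-≼-∼ x y (suc e) s∼s′ l (skip p) = skip (^-++-∷-≼-∼ x y e s∼s′ l p)

-- A factor of length K + 1 either starts inside the block x^(e+1), leaving at most K letters,
-- or starts with other x and so embeds into other x ∷ s.
arch-∼ : ∀ {K s s′} x e → s ∼[ K ] s′ → arch x e s ∼[ suc K ] arch x e s′
arch-∼ x e s∼s′ = ≼⇔⇒∼ (transfer s∼s′) (transfer (∼-sym s∼s′))
  where
  transfer : ∀ {K s s′} → s ∼[ K ] s′ → ∀ z → length z ≤ suc K → z ≼ arch x e s → z ≼ arch x e s′
  transfer s∼s′ [] l p = []≼
  transfer s∼s′ (c ∷ z) (s≤s l) p with ≡-or-≡other c x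
  ... | inj₁ refl = keep (^-++-∷-≼-∼ x (other x) e s∼s′ l (∷≼∷⁻ p))
  ... | inj₂ refl = ≼-^-++ x (suc e) (keep (∼⇒≼ s∼s′ l (other∷≼^-++-other∷⁻ x (suc e) p)))

^-++-other∷-∼⁻ : ∀ {K s s′} x e e′ → (x ^ e ++ other x ∷ s) ∼[ suc K ] (x ^ e′ ++ other x ∷ s′) →
                 s ∼[ K ] s′
^-++-other∷-∼⁻ x e e′ w∼w′ = ≼⇔⇒∼ (transfer e e′ w∼w′) (transfer e′ e (∼-sym w∼w′))
  where
  transfer : ∀ {K s s′} e e′ → (x ^ e ++ other x ∷ s) ∼[ suc K ] (x ^ e′ ++ other x ∷ s′) →
             ∀ z → length z ≤ K → z ≼ s → z ≼ s′
  transfer e e′ w∼w′ z l p = other∷≼^-++-other∷⁻ x e′ (∼⇒≼ w∼w′ (s≤s l) (≼-^-++ x e (keep p)))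

-- Every y u with |u| = m embeds into x^(e+1) y s, hence into y^(e′+1) x s′ and so into s′ after
-- the leading y; thus x ∷ s′ is (m+1)-universal and pulling the factors of y^(e′+1) x s′ back
-- makes s (m+1)-universal.
¬arch-∼-other-letter : ∀ {m K s s′} x y e e′ → x ≢ y → suc m ≤ K → HasIota m s → Universal m s′ →
                       ¬ ((x ^ suc e ++ y ∷ s) ∼[ suc K ] (y ^ suc e′ ++ x ∷ s′))
¬arch-∼-other-letter {m} {K} {s} {s′} x y e e′ x≢y m<K (U , ¬U) U′ w∼w′ = ¬U universal-s
  where
  short : ∀ {u} n → length u ≡ n → n ≤ K → length u ≤ K
  short n l n≤K = subst (_≤ K) (sym l) n≤K
  y∷-≼s′ : ∀ u → length u ≡ m → (y ∷ u) ≼ s′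
  y∷-≼s′ u l = ∷≼∷⁻ (≢-∷≼^-++⁻ y (suc e′) x≢y
                 (∼⇒≼ w∼w′ (s≤s (short {y ∷ u} (suc m) (cong suc l) m<K)) (keep (≼-^-++ x e (keep (U u l))))))
  universal-x∷s′ : Universal (suc m) (x ∷ s′)
  universal-x∷s′ (c ∷ t) l with ≡-or-≡other c x | ≡-or-≡other y x
  ... | inj₁ refl | _ = keep (U′ t (cong pred l))
  ... | inj₂ refl | inj₁ refl = ⊥-elim (x≢y refl)
  ... | inj₂ refl | inj₂ refl = skip (y∷-≼s′ t (cong pred l))
  universal-s : Universal (suc m) s
  universal-s t l = ∷≼∷⁻ (≢-∷≼^-++⁻ x (suc e) (λ q → x≢y (sym q))
                     (∼⇒≼ (∼-sym w∼w′) (s≤s (short {t} (suc m) l m<K))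
                          (keep (≼-^-++ y e′ (universal-x∷s′ t l)))))

arch-∼⁻ : ∀ {m K s s′} x x′ e e′ → suc m ≤ K → HasIota m s → HasIota m s′ →
          arch x e s ∼[ suc K ] arch x′ e′ s′ → x ≡ x′ × s ∼[ K ] s′
arch-∼⁻ a a e e′ m<K ι ι′ w∼w′ = refl , ^-++-other∷-∼⁻ a (suc e) (suc e′) w∼w′
arch-∼⁻ b b e e′ m<K ι ι′ w∼w′ = refl , ^-++-other∷-∼⁻ b (suc e) (suc e′) w∼w′
arch-∼⁻ a b e e′ m<K ι ι′ w∼w′ = ⊥-elim (¬arch-∼-other-letter a b e e′ (λ ()) m<K ι (proj₁ ι′) w∼w′)
arch-∼⁻ b a e e′ m<K ι ι′ w∼w′ = ⊥-elim (¬arch-∼-other-letter b a e e′ (λ ()) m<K ι (proj₁ ι′) w∼w′)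

universal-via-∷other∷ : ∀ {m s} x → (∀ u → length u ≡ m → (x ∷ other x ∷ u) ≼ s) → Universal (suc m) s
universal-via-∷other∷ x H (c ∷ t) l with ≡-or-≡other c x
... | inj₁ refl = ≼-trans (keep (skip ≼-refl)) (H t (cong pred l))
... | inj₂ refl = ≼-trans (skip ≼-refl) (H t (cong pred l))

-- A witness x (other x) u ⋠ s with |u| = m exists as s is not (m+1)-universal; then
-- x^(E+1) (other x) u separates the two words.
¬^-++-∼-below : ∀ {m s} d x {E E′} → HasIota m s → E < E′ → suc E ≤ d →
                ¬ ((x ^ E ++ other x ∷ s) ∼[ suc (m + d) ] (x ^ E′ ++ other x ∷ s))
¬^-++-∼-below {m} {s} d x {E} {E′} (U , ¬U) E<E′ E<d w∼w′
  with ∀-ofLength? m (λ u → (x ∷ other x ∷ u) ≼ s) (λ u → (x ∷ other x ∷ u) ≼? s)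
... | inj₁ all = ¬U (universal-via-∷other∷ x all)
... | inj₂ (u , l , ¬p) = ¬p (≢-∷≼∷⁻ (other-≢ x) (^-++-≼⁻ x E (subst (_≼ _) (sym (^-++-∷ x E _)) into-w)))
  where
  short : length (x ^ suc E ++ other x ∷ u) ≤ suc (m + d)
  short = ≤-trans (≤-reflexive (trans (length-^-++ x (suc E) (other x ∷ u))
                                      (trans (cong (λ n → suc E + suc n) l) (+-suc (suc E) m))))
                  (s≤s (≤-trans (+-monoˡ-≤ m E<d) (≤-reflexive (+-comm d m))))
  into-w : (x ^ suc E ++ other x ∷ u) ≼ (x ^ E ++ other x ∷ s)
  into-w = ∼⇒≼ (∼-sym w∼w′) short (^-++-≼-mono x E<E′ (keep (U u l)))

-- As above, with a witness x u ⋠ s, |u| = m, and the separating word x^(d+1) u.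
¬^-++-∼-at : ∀ {m s} d x {E E′} → Universal m s → ¬ StartUniversal x m s → E ≡ d → E < E′ →
             ¬ ((x ^ E ++ other x ∷ s) ∼[ suc (m + d) ] (x ^ E′ ++ other x ∷ s))
¬^-++-∼-at {m} {s} d x U ¬S refl d<E′ w∼w′
  with ∀-ofLength? m (λ u → (x ∷ u) ≼ s) (λ u → (x ∷ u) ≼? s)
... | inj₁ all = ¬S all
... | inj₂ (u , l , ¬p) = ¬p (≢-∷≼∷⁻ (other-≢ x) (^-++-≼⁻ x d (subst (_≼ _) (sym (^-++-∷ x d _)) into-w)))
  where
  short : length (x ^ suc d ++ u) ≤ suc (m + d)
  short = ≤-reflexive (trans (length-^-++ x (suc d) u) (cong suc (trans (cong (λ k → d + k) l) (+-comm d m))))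
  into-w : (x ^ suc d ++ u) ≼ (x ^ d ++ other x ∷ s)
  into-w = ∼⇒≼ (∼-sym w∼w′) short (^-++-≼-mono x d<E′ (skip (U u l)))

^-++-drop : ∀ {m W z} x e → Universal m W → length z ≤ m + e → z ≼ (x ^ suc e ++ W) → z ≼ (x ^ e ++ W)
^-++-drop {m} {z = z} x zero U l p = universal⇒≼ U (subst (length z ≤_) (+-identityʳ m) l)
^-++-drop x (suc e) U l []≼ = []≼
^-++-drop {m} {z = _ ∷ z} x (suc e) U l (keep p) =
  keep (^-++-drop x e U (≤-pred (subst (suc (length z) ≤_) (+-suc m e) l)) p)
^-++-drop x (suc e) U l (skip p) = p

^-++-drop-started : ∀ {m W z} x e → StartUniversal x m W → length z ≤ suc (m + e) →
                    z ≼ (x ^ suc e ++ W) → z ≼ (x ^ e ++ W)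
^-++-drop-started x zero S l []≼ = []≼
^-++-drop-started {m} {z = _ ∷ z} x zero S l (keep p) = startUniversal⇒≼ S (subst (length z ≤_) (+-identityʳ m) (≤-pred l))
^-++-drop-started x zero S l (skip p) = p
^-++-drop-started x (suc e) S l []≼ = []≼
^-++-drop-started {m} {z = _ ∷ z} x (suc e) S l (keep p) =
  keep (^-++-drop-started x e S (≤-pred (subst (suc (length z) ≤_) (cong suc (+-suc m e)) l)) p)
^-++-drop-started x (suc e) S l (skip p) = p

^-++-∼-saturate : ∀ {L x c₀ W} →
                  (∀ {e z} → c₀ ≤ e → length z ≤ L → z ≼ (x ^ suc e ++ W) → z ≼ (x ^ e ++ W)) →
                  ∀ {e} → c₀ ≤ e → (x ^ e ++ W) ∼[ L ] (x ^ c₀ ++ W)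
^-++-∼-saturate {L} {x} {c₀} {W} drop c₀≤e = go (≤⇒≤′ c₀≤e)
  where
  go : ∀ {e} → c₀ ≤′ e → (x ^ e ++ W) ∼[ L ] (x ^ c₀ ++ W)
  go ≤′-refl = ∼-refl
  go {suc e′} (≤′-step c₀≤′e) = ∼-trans (≼⇔⇒∼ (λ z l → drop (≤′⇒≤ c₀≤′e) l)
                                      (λ z l p → ≼-trans p (^-++-≼-mono x {i = e′} (n≤1+n _) ≼-refl)))
                               (go c₀≤′e)

arch-saturate-started : ∀ {m s} x d₀ {e} → StartUniversal x m s → d₀ ≤ e →
                        arch x e s ∼[ suc (m + suc d₀) ] arch x d₀ s
arch-saturate-started {m} x d₀ S d₀≤e =
  ^-++-∼-saturate (λ {e′} d<e′ l → ^-++-drop-started x e′ (λ t l′ → skip (S t l′))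
                                     (≤-trans l (s≤s (+-monoʳ-≤ m d<e′))))
                  (s≤s d₀≤e)

arch-saturate-unstarted : ∀ {m s} x d {e} → Universal m s → d ≤ e →
                          arch x e s ∼[ suc (m + d) ] arch x d s
arch-saturate-unstarted {m} x d U d≤e =
  ^-++-∼-saturate (λ {e′} d<e′ l → ^-++-drop x e′ (λ t l′ → skip (U t l′))
                                     (≤-trans l (≤-trans (≤-reflexive (sym (+-suc m d))) (+-monoʳ-≤ m d<e′))))
                  (s≤s d≤e)

-- Classifications up to Simon's congruence

record Classification (K : ℕ) (P : Pred Word 0ℓ) (I : Set) : Set where
  field
    rep           : I → Word
    rep-sound     : ∀ i → P (rep i)
    rep-injective : ∀ i j → rep i ∼[ K ] rep j → i ≡ j
    rep-complete  : ∀ {w} → P w → ∃[ i ] (w ∼[ K ] rep i)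

Apart : ℕ → Pred Word 0ℓ → Pred Word 0ℓ → Set
Apart K P Q = ∀ {u v} → P u → Q v → ¬ (u ∼[ K ] v)

apart-∪ˡ : ∀ {K P₁ P₂ Q} → Apart K P₁ Q → Apart K P₂ Q → Apart K (P₁ ∪ P₂) Q
apart-∪ˡ apart₁ apart₂ (inj₁ p) = apart₁ p
apart-∪ˡ apart₁ apart₂ (inj₂ p) = apart₂ p

module _ {K : ℕ} where

  reindex : ∀ {P I J} → J ↔ I → Classification K P I → Classification K P J
  reindex {J = J} J↔I C = record
    { rep           = rep ∘ to
    ; rep-sound     = rep-sound ∘ to
    ; rep-injective = injective
    ; rep-complete  = complete
    }
    where
    open Classification C
    open Inverse J↔I
    injective : ∀ i j → rep (to i) ∼[ K ] rep (to j) → i ≡ j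
    injective i j r = trans (sym (strictlyInverseʳ i))
                            (trans (cong from (rep-injective (to i) (to j) r)) (strictlyInverseʳ j))
    complete : ∀ {w} → _ → ∃[ j ] (w ∼[ K ] rep (to j))
    complete {w} p with rep-complete p
    ... | i , w∼ = from i , subst (λ i′ → w ∼[ K ] rep i′) (sym (strictlyInverseˡ i)) w∼

  ≐-classification : ∀ {P Q I} → P ≐ Q → Classification K P I → Classification K Q I
  ≐-classification (P⊆Q , Q⊆P) C = record
    { rep = rep ; rep-sound = P⊆Q ∘ rep-sound ; rep-injective = rep-injective ; rep-complete = rep-complete ∘ Q⊆P }
    where open Classification C

  ⊎-classification : ∀ {P Q I J} → Classification K P I → Classification K Q J → Apart K P Q →
                     Classification K (P ∪ Q) (I ⊎ J)
  ⊎-classification {P} {Q} {I} {J} C D apart = record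
    { rep = rep ; rep-sound = sound ; rep-injective = injective ; rep-complete = complete }
    where
    module C = Classification C
    module D = Classification D
    rep : I ⊎ J → Word
    rep (inj₁ i) = C.rep i
    rep (inj₂ j) = D.rep j
    sound : ∀ k → (P ∪ Q) (rep k)
    sound (inj₁ i) = inj₁ (C.rep-sound i)
    sound (inj₂ j) = inj₂ (D.rep-sound j)
    injective : ∀ k k′ → rep k ∼[ K ] rep k′ → k ≡ k′
    injective (inj₁ i) (inj₁ i′) r = cong inj₁ (C.rep-injective i i′ r)
    injective (inj₁ i) (inj₂ j′) r = ⊥-elim (apart (C.rep-sound i) (D.rep-sound j′) r)
    injective (inj₂ j) (inj₁ i′) r = ⊥-elim (apart (C.rep-sound i′) (D.rep-sound j) (∼-sym r))
    injective (inj₂ j) (inj₂ j′) r = cong inj₂ (D.rep-injective j j′ r)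
    complete : ∀ {w} → (P ∪ Q) w → ∃[ k ] (w ∼[ K ] rep k)
    complete (inj₁ p) with C.rep-complete p
    ... | i , w∼ = inj₁ i , w∼
    complete (inj₂ q) with D.rep-complete q
    ... | j , w∼ = inj₂ j , w∼

  ∪-classification : ∀ {P Q n₁ n₂} → Classification K P (Fin n₁) → Classification K Q (Fin n₂) → Apart K P Q →
                     Classification K (P ∪ Q) (Fin (n₁ + n₂))
  ∪-classification C D apart = reindex +↔⊎ (⊎-classification C D apart)

ArchOver : ℕ → Pred Word 0ℓ → Pred Word 0ℓ
ArchOver m P w = ∃[ x ] ∃[ e ] ∃[ s ] (w ≡ arch x e s × HasIota m s × P s)

archOver-apart : ∀ {m K P P′ Q} → suc m ≤ K → Apart K (HasIota m ∩ P) (HasIota m ∩ P′) →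
                 Apart (suc K) (ArchOver m P ∩ Q) (ArchOver m P′ ∩ Q)
archOver-apart m<K apart ((x , e , s , refl , ι , p) , _) ((x′ , e′ , s′ , refl , ι′ , p′) , _) w∼w′ =
  apart (ι , p) (ι′ , p′) (proj₂ (arch-∼⁻ x x′ e e′ m<K ι ι′ w∼w′))

module _ {m K : ℕ} (m<K : suc m ≤ K) {P Q : Pred Word 0ℓ} {W n : ℕ}
         (tails : Classification K (HasIota m ∩ P) (Fin n))
         (letter : Fin W → Letter) (exponent : Fin W → ℕ) where

  open Classification tails

  head : Fin W → Word → Word
  head c = arch (letter c) (exponent c)

  archClassification :
    (∀ c {s} → HasIota m s → P s → Q (head c s)) →
    (∀ c c′ {s} → HasIota m s → P s → head c s ∼[ suc K ] head c′ s → c ≡ c′) →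
    (∀ x e {s s′} → HasIota m s → P s → HasIota m s′ → P s′ → s ∼[ K ] s′ → Q (arch x e s) →
       ∃[ c ] (arch x e s ∼[ suc K ] head c s′)) →
    Classification (suc K) (ArchOver m P ∩ Q) (Fin W × Fin n)
  archClassification head-sound head-injective head-complete = record
    { rep = archRep
    ; rep-sound = sound
    ; rep-injective = injective
    ; rep-complete = complete
    }
    where
    archRep : Fin W × Fin n → Word
    archRep (c , i) = head c (rep i)
    sound : ∀ ci → (ArchOver m P ∩ Q) (archRep ci)
    sound (c , i) = (letter c , exponent c , rep i , refl , rep-sound i)
                  , head-sound c (proj₁ (rep-sound i)) (proj₂ (rep-sound i))
    injective : ∀ ci ci′ → archRep ci ∼[ suc K ] archRep ci′ → ci ≡ ci′
    injective (c , i) (c′ , i′) w∼w′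
      with rep-injective i i′ (proj₂ (arch-∼⁻ _ _ _ _ m<K (proj₁ (rep-sound i)) (proj₁ (rep-sound i′)) w∼w′))
    ... | refl with head-injective c c′ (proj₁ (rep-sound i)) (proj₂ (rep-sound i)) w∼w′
    ...   | refl = refl
    complete : ∀ {w} → (ArchOver m P ∩ Q) w → ∃[ ci ] (w ∼[ suc K ] archRep ci)
    complete ((x , e , s , refl , ι , p) , q) with rep-complete (ι , p)
    ... | i , s∼ with head-complete x e ι p (proj₁ (rep-sound i)) (proj₂ (rep-sound i)) s∼ q
    ...   | c , w∼ = (c , i) , w∼

hasIota-≐ : ∀ m → overStarts m (HasIota m ∩_) ≐ HasIota m
hasIota-≐ m = ⊆-hasIota , hasIota-⊆
  where
  ⊆-hasIota : overStarts m (HasIota m ∩_) ⊆ HasIota m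
  ⊆-hasIota (inj₁ (inj₁ (ι , _))) = ι
  ⊆-hasIota (inj₁ (inj₂ (ι , _))) = ι
  ⊆-hasIota (inj₂ (ι , _)) = ι
  hasIota-⊆ : HasIota m ⊆ overStarts m (HasIota m ∩_)
  hasIota-⊆ {w} ι with trichotomy m w
  ... | inj₁ (inj₁ Sa) = inj₁ (inj₁ (ι , Sa))
  ... | inj₁ (inj₂ N) = inj₁ (inj₂ (ι , N))
  ... | inj₂ Sb = inj₂ (ι , Sb)

arches-≐ : ∀ m (Q : Pred Word 0ℓ) → overStarts m (λ P → ArchOver m P ∩ Q) ≐ HasIota (suc m) ∩ Q
arches-≐ m Q = ⊆-hasIota , hasIota-⊆
  where
  archOver⇒hasIota : ∀ {P w} → ArchOver m P w → HasIota (suc m) w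
  archOver⇒hasIota (x , e , s , refl , ι , _) = arch-hasIota x e ι
  ⊆-hasIota : overStarts m (λ P → ArchOver m P ∩ Q) ⊆ HasIota (suc m) ∩ Q
  ⊆-hasIota (inj₁ (inj₁ (o , q))) = archOver⇒hasIota o , q
  ⊆-hasIota (inj₁ (inj₂ (o , q))) = archOver⇒hasIota o , q
  ⊆-hasIota (inj₂ (o , q)) = archOver⇒hasIota o , q
  hasIota-⊆ : HasIota (suc m) ∩ Q ⊆ overStarts m (λ P → ArchOver m P ∩ Q)
  hasIota-⊆ {w} (ι , q) with arch-decomposition w ι
  ... | x , e , s , w≡ , ιs with trichotomy m s
  ...   | inj₁ (inj₁ Sa) = inj₁ (inj₁ ((x , e , s , w≡ , ιs , Sa) , q))
  ...   | inj₁ (inj₂ N) = inj₁ (inj₂ ((x , e , s , w≡ , ιs , N) , q))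
  ...   | inj₂ Sb = inj₂ ((x , e , s , w≡ , ιs , Sb) , q)

module _ {m K : ℕ} (m<K : suc m ≤ K) where

  apart-a-neutral : Apart K (HasIota m ∩ StartUniversal a m) (HasIota m ∩ Neutral m)
  apart-a-neutral (_ , Sa) (_ , ¬Sa , _) u∼v = ¬Sa (startUniversal-∼ u∼v m<K Sa)

  apart-neutral-b : Apart K (HasIota m ∩ Neutral m) (HasIota m ∩ StartUniversal b m)
  apart-neutral-b (_ , _ , ¬Sb) (_ , Sb) u∼v = ¬Sb (startUniversal-∼ (∼-sym u∼v) m<K Sb)

  apart-a-b : Apart K (HasIota m ∩ StartUniversal a m) (HasIota m ∩ StartUniversal b m)
  apart-a-b (_ , Sa) ((_ , ¬U) , Sb) u∼v = ¬U (startUniversal-both⇒universal (startUniversal-∼ u∼v m<K Sa) Sb)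

<-separated⇒injective : ∀ {n} {R : Fin n → Fin n → Set} → (∀ {c c′} → R c c′ → R c′ c) →
                        (∀ {c c′} → toℕ c < toℕ c′ → ¬ R c c′) → ∀ c c′ → R c c′ → c ≡ c′
<-separated⇒injective R-sym separated c c′ r with <-cmp (toℕ c) (toℕ c′)
... | tri< c<c′ _ _ = ⊥-elim (separated c<c′ r)
... | tri≈ _ c≡c′ _ = toℕ-injective c≡c′
... | tri> _ _ c′<c = ⊥-elim (separated c′<c (R-sym r))

-- The classes with ι = m

module Construction (d₀ : ℕ) where

  d : ℕ
  d = suc d₀

  m<m+d : ∀ m → suc m ≤ m + d
  m<m+d m = subst (suc m ≤_) (sym (+-suc m d₀)) (s≤s (m≤m+n m d₀))

  capped : ∀ e → ∃[ c ] (toℕ {d} c ≡ e ⊎ (toℕ c ≡ d₀ × d₀ ≤ e))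
  capped e with e <? d
  ... | yes e<d = fromℕ< e<d , inj₁ (toℕ-fromℕ< e<d)
  ... | no e≮d = fromℕ d₀ , inj₂ (toℕ-fromℕ d₀ , ≤-trans (n≤1+n d₀) (≮⇒≥ e≮d))

  module _ {m n : ℕ} {P : Pred Word 0ℓ} (tails : Classification (m + d) (HasIota m ∩ P) (Fin n)) where

    startedArches : ∀ x → HasIota m ∩ P ⊆ StartUniversal x m →
                    Classification (suc (m + d)) (ArchOver m P ∩ StartUniversal x (suc m)) (Fin (d * n))
    startedArches x P⊆S = reindex *↔× (archClassification (m<m+d m) tails (λ _ → x) toℕ sound injective complete)
      where
      sound : ∀ c {s} → HasIota m s → P s → StartUniversal x (suc m) (arch x (toℕ c) s)
      sound c ι p = startUniversal-arch x (toℕ c) (proj₁ ι) (P⊆S (ι , p))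
      injective : ∀ c c′ {s} → HasIota m s → P s →
                  arch x (toℕ c) s ∼[ suc (m + d) ] arch x (toℕ c′) s → c ≡ c′
      injective c c′ ι _ = <-separated⇒injective ∼-sym
        (λ {c} {c′} c<c′ → ¬^-++-∼-below d x ι (s≤s c<c′) (≤-trans (s≤s c<c′) (toℕ<n c′))) c c′
      complete : ∀ y e {s s′} → HasIota m s → P s → HasIota m s′ → P s′ → s ∼[ m + d ] s′ →
                 StartUniversal x (suc m) (arch y e s) → ∃[ c ] (arch y e s ∼[ suc (m + d) ] arch x (toℕ c) s′)
      complete y e {s′ = s′} (_ , ¬U) _ ι′ p′ s∼s′ S with startUniversal-arch⇒≡ x y e ¬U S
      ... | refl with capped e
      ...   | c , inj₁ refl = c , arch-∼ x e s∼s′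
      ...   | c , inj₂ (c≡d₀ , d₀≤e) =
        c , ∼-trans (arch-∼ x e s∼s′)
                    (subst (λ e′ → arch x e s′ ∼[ suc (m + d) ] arch x e′ s′) (sym c≡d₀)
                           (arch-saturate-started x d₀ (P⊆S (ι′ , p′)) d₀≤e))

    unstartedArches : ∀ x → HasIota m ∩ P ⊆ (¬_ ∘ StartUniversal x m) →
                      Classification (suc (m + d)) (ArchOver m P ∩ StartUniversal x (suc m)) (Fin (d * n))
    unstartedArches x P⊆¬S =
      reindex *↔× (archClassification (m<m+d m) tails (λ _ → x) (suc ∘ toℕ) sound injective complete)
      where
      sound : ∀ c {s} → HasIota m s → P s → StartUniversal x (suc m) (arch x (suc (toℕ c)) s)
      sound c (U , _) p = startUniversal-arch-suc x (toℕ c) U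
      separated : ∀ {s} → HasIota m s → P s → ∀ {c c′ : Fin d} → toℕ c < toℕ c′ →
                  ¬ (arch x (suc (toℕ c)) s ∼[ suc (m + d) ] arch x (suc (toℕ c′)) s)
      separated ι p {c} {c′} c<c′ with suc (suc (suc (toℕ c))) ≤? d
      ... | yes E<d = ¬^-++-∼-below d x ι (s≤s (s≤s c<c′)) E<d
      ... | no E≮d = ¬^-++-∼-at d x (proj₁ ι) (P⊆¬S (ι , p))
                       (≤-antisym (≤-trans (s≤s c<c′) (toℕ<n c′)) (≤-pred (≰⇒> E≮d))) (s≤s (s≤s c<c′))
      injective : ∀ c c′ {s} → HasIota m s → P s →
                  arch x (suc (toℕ c)) s ∼[ suc (m + d) ] arch x (suc (toℕ c′)) s → c ≡ c′
      injective c c′ ι p = <-separated⇒injective ∼-sym (separated ι p) c c′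
      complete : ∀ y e {s s′} → HasIota m s → P s → HasIota m s′ → P s′ → s ∼[ m + d ] s′ →
                 StartUniversal x (suc m) (arch y e s) → ∃[ c ] (arch y e s ∼[ suc (m + d) ] arch x (suc (toℕ c)) s′)
      complete y e ι p _ _ s∼s′ S with startUniversal-arch⇒≡ x y e (proj₂ ι) S
      complete y zero ι p _ _ s∼s′ S | refl = ⊥-elim (P⊆¬S (ι , p) (startUniversal-arch-zero⁻ x S))
      complete y (suc e) {s′ = s′} ι p (U′ , _) _ s∼s′ S | refl with capped e
      ... | c , inj₁ refl = c , arch-∼ x (suc e) s∼s′
      ... | c , inj₂ (c≡d₀ , d₀≤e) =
        c , ∼-trans (arch-∼ x (suc e) s∼s′)
                    (subst (λ e′ → arch x (suc e) s′ ∼[ suc (m + d) ] arch x (suc e′) s′) (sym c≡d₀)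
                           (arch-saturate-unstarted x d U′ (s≤s d₀≤e)))

    neutralArches : ∀ {W} (letter : Fin W → Letter) → (∀ c c′ → letter c ≡ letter c′ → c ≡ c′) →
                    (∀ c → HasIota m ∩ P ⊆ (¬_ ∘ StartUniversal (letter c) m)) →
                    (∀ x {s} → (HasIota m ∩ P) s → ¬ StartUniversal x m s → ∃[ c ] (letter c ≡ x)) →
                    Classification (suc (m + d)) (ArchOver m P ∩ Neutral (suc m)) (Fin (W * n))
    neutralArches letter letter-injective excluded covered =
      reindex *↔× (archClassification (m<m+d m) tails letter (λ _ → 0) sound injective complete)
      where
      sound : ∀ c {s} → HasIota m s → P s → Neutral (suc m) (arch (letter c) 0 s)
      sound c ι p = neutral-arch (letter c) ι (excluded c (ι , p))
      injective : ∀ c c′ {s} → HasIota m s → P s →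
                  arch (letter c) 0 s ∼[ suc (m + d) ] arch (letter c′) 0 s → c ≡ c′
      injective c c′ ι _ w∼w′ = letter-injective c c′ (proj₁ (arch-∼⁻ _ _ 0 0 (m<m+d m) ι ι w∼w′))
      complete : ∀ y e {s s′} → HasIota m s → P s → HasIota m s′ → P s′ → s ∼[ m + d ] s′ →
                 Neutral (suc m) (arch y e s) → ∃[ c ] (arch y e s ∼[ suc (m + d) ] arch (letter c) 0 s′)
      complete y (suc e) (U , _) _ _ _ _ N = ⊥-elim (¬neutral-startUniversal y N (startUniversal-arch-suc y e U))
      complete y zero ι p _ _ s∼s′ N
        with covered y (ι , p) (λ S → ¬neutral-startUniversal y N (startUniversal-arch-zero y (proj₁ ι) S))
      ... | c , refl = c , arch-∼ (letter c) 0 s∼s′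

  transfer : Mat3
  transfer = mat ⟨ d , d , d ⟩ ⟨ 1 , 2 , 1 ⟩ ⟨ d , d , d ⟩

  counts : ℕ → Vec3
  counts m = pow· transfer m ⟨ d , 1 , d ⟩

  record Classes (m : ℕ) : Set where
    field
      started-a : Classification (m + d) (HasIota m ∩ StartUniversal a m) (Fin (Vec3.x₁ (counts m)))
      neutral   : Classification (m + d) (HasIota m ∩ Neutral m) (Fin (Vec3.x₂ (counts m)))
      started-b : Classification (m + d) (HasIota m ∩ StartUniversal b m) (Fin (Vec3.x₃ (counts m)))

  unaryClassification : ∀ x → Classification d (HasIota 0 ∩ StartUniversal x 0) (Fin d)
  unaryClassification x = record
    { rep = λ c → x ^ suc (toℕ c)
    ; rep-sound = λ c → (universal-0 _ , ¬universal-^ x _) , λ { [] refl → keep []≼ }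
    ; rep-injective = <-separated⇒injective ∼-sym separated
    ; rep-complete = complete
    }
    where
    separated : ∀ {c c′ : Fin d} → toℕ c < toℕ c′ → ¬ (x ^ suc (toℕ c) ∼[ d ] x ^ suc (toℕ c′))
    separated {c} {c′} c<c′ w∼w′ =
      n≮n _ (≤-trans (s≤s c<c′) (subst₂ _≤_ (length-replicate _) (length-replicate _) (≼-length longer≼shorter)))
      where
      longer≼shorter : x ^ suc (toℕ c′) ≼ x ^ suc (toℕ c)
      longer≼shorter = ∼⇒≼ (∼-sym w∼w′) (subst (_≤ d) (sym (length-replicate _)) (toℕ<n c′)) ≼-refl
    saturate : ∀ {e} → d ≤ e → x ^ e ∼[ d ] x ^ d
    saturate d≤e = subst₂ _∼[ d ]_ (++-identityʳ _) (++-identityʳ _)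
                          (^-++-∼-saturate (λ {e} d≤e′ l → ^-++-drop x e (universal-0 []) (≤-trans l d≤e′)) d≤e)
    complete : ∀ {w} → (HasIota 0 ∩ StartUniversal x 0) w → ∃[ c ] (w ∼[ d ] x ^ suc (toℕ c))
    complete {w} ((_ , ¬U) , S) with leading-run x w
    ... | inj₂ (f , s , refl) = ⊥-elim (¬U (universal-1 x (S [] refl) (≼-^-++ x f (keep []≼))))
    ... | inj₁ (zero , refl) with S [] refl
    ...   | ()
    complete {w} ((_ , ¬U) , S) | inj₁ (suc e , refl) with capped e
    ...   | c , inj₁ refl = c , ∼-refl
    ...   | c , inj₂ (c≡d₀ , d₀≤e) =
      c , subst (λ e′ → x ^ suc e ∼[ d ] x ^ suc e′) (sym c≡d₀) (saturate (s≤s d₀≤e))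

  emptyClassification : Classification d (HasIota 0 ∩ Neutral 0) (Fin 1)
  emptyClassification = record
    { rep = λ _ → []
    ; rep-sound = λ _ → (universal-0 [] , ¬universal-^ a 0) , ¬∷≼[] , ¬∷≼[]
    ; rep-injective = λ { fzero fzero _ → refl }
    ; rep-complete = complete
    }
    where
    ¬∷≼[] : ∀ {x} → ¬ StartUniversal x 0 []
    ¬∷≼[] S with S [] refl
    ... | ()
    complete : ∀ {w} → (HasIota 0 ∩ Neutral 0) w → ∃[ c ] (w ∼[ d ] [])
    complete {[]} _ = fzero , ∼-refl
    complete {c ∷ w} (_ , N) = ⊥-elim (¬neutral-startUniversal c N λ { [] refl → keep []≼ })

  archesByTail : ∀ {m n₁ n₂ n₃ Q} →
    Classification (suc (m + d)) (ArchOver m (StartUniversal a m) ∩ Q) (Fin n₁) →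
    Classification (suc (m + d)) (ArchOver m (Neutral m) ∩ Q) (Fin n₂) →
    Classification (suc (m + d)) (ArchOver m (StartUniversal b m) ∩ Q) (Fin n₃) →
    Classification (suc (m + d)) (HasIota (suc m) ∩ Q) (Fin (n₁ + n₂ + n₃))
  archesByTail {m} {Q = Q} A N B =
    ≐-classification (arches-≐ m Q)
      (∪-classification (∪-classification A N (archOver-apart m<K (apart-a-neutral m<K)))
                        B (apart-∪ˡ (archOver-apart m<K (apart-a-b m<K)) (archOver-apart m<K (apart-neutral-b m<K))))
    where
    m<K = m<m+d m

  level : ∀ m → Classes m
  level zero = record
    { started-a = unaryClassification a
    ; neutral = emptyClassification
    ; started-b = unaryClassification b }
  level (suc m) = record
    { started-a = archesByTail (startedArches started-a a proj₂)
                               (unstartedArches neutral a (proj₁ ∘ proj₂))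
                               (unstartedArches started-b a ¬a-of-b)
    ; neutral   = archesByTail (neutralArches started-a (λ _ → b) single-injective (λ _ → ¬b-of-a) only-b)
                               (neutralArches neutral ab ab-injective (λ c → ¬neutral-startUniversal (ab c) ∘ proj₂) any)
                               (neutralArches started-b (λ _ → a) single-injective (λ _ → ¬a-of-b) only-a)
    ; started-b = archesByTail (unstartedArches started-a b ¬b-of-a)
                               (unstartedArches neutral b (proj₂ ∘ proj₂))
                               (startedArches started-b b proj₂)
    }
    where
    open Classes (level m)
    ¬b-of-a : HasIota m ∩ StartUniversal a m ⊆ (¬_ ∘ StartUniversal b m)
    ¬b-of-a ((_ , ¬U) , Sa) Sb = ¬U (startUniversal-both⇒universal Sa Sb)
    ¬a-of-b : HasIota m ∩ StartUniversal b m ⊆ (¬_ ∘ StartUniversal a m)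
    ¬a-of-b ((_ , ¬U) , Sb) Sa = ¬U (startUniversal-both⇒universal Sa Sb)
    single-injective : ∀ {x : Letter} (c c′ : Fin 1) → x ≡ x → c ≡ c′
    single-injective fzero fzero _ = refl
    only-b : ∀ x {s} → (HasIota m ∩ StartUniversal a m) s → ¬ StartUniversal x m s → ∃[ c ] (b ≡ x)
    only-b a (_ , Sa) ¬Sa = ⊥-elim (¬Sa Sa)
    only-b b _ _ = fzero , refl
    only-a : ∀ x {s} → (HasIota m ∩ StartUniversal b m) s → ¬ StartUniversal x m s → ∃[ c ] (a ≡ x)
    only-a b (_ , Sb) ¬Sb = ⊥-elim (¬Sb Sb)
    only-a a _ _ = fzero , refl
    ab : Fin 2 → Letter
    ab fzero = a
    ab (fsuc fzero) = b
    ab-injective : ∀ c c′ → ab c ≡ ab c′ → c ≡ c′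
    ab-injective fzero fzero _ = refl
    ab-injective fzero (fsuc fzero) ()
    ab-injective (fsuc fzero) fzero ()
    ab-injective (fsuc fzero) (fsuc fzero) _ = refl
    any : ∀ x {s} → (HasIota m ∩ Neutral m) s → ¬ StartUniversal x m s → ∃[ c ] (ab c ≡ x)
    any a _ _ = fzero , refl
    any b _ _ = fsuc fzero , refl

  classification : ∀ m → Classification (m + d) (HasIota m) (Fin (norm1 (counts m)))
  classification m =
    ≐-classification (hasIota-≐ m)
      (∪-classification (∪-classification started-a neutral (apart-a-neutral m<K))
                        started-b (apart-∪ˡ (apart-a-b m<K) (apart-neutral-b m<K)))
    where
    open Classes (level m)
    m<K = m<m+d m

  norm : ℕ → ℕ
  norm m = norm1 (counts m)

  previousNorm : ℕ → ℕ
  previousNorm zero = 1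
  previousNorm (suc m) = norm m

  outer-counts : ∀ m → Vec3.x₁ (counts m) ≡ d * previousNorm m × Vec3.x₃ (counts m) ≡ d * previousNorm m
  outer-counts zero = sym (*-identityʳ d) , sym (*-identityʳ d)
  outer-counts (suc m) = distrib d x₁ x₂ x₃ , distrib d x₁ x₂ x₃
    where
    open Vec3 (counts m)
    distrib : ∀ e u₁ u₂ u₃ → e * u₁ + e * u₂ + e * u₃ ≡ e * (u₁ + u₂ + u₃)
    distrib = ℕ-Solver.solve-∀

  norm-recurrence : ∀ m → norm (suc m) + 2 * d * previousNorm m ≡ 2 * (d + 1) * norm m
  norm-recurrence m = identity d _ _ _ (previousNorm m) (proj₁ (outer-counts m)) (proj₂ (outer-counts m))
    where
    polynomial : ∀ e u₂ w → (e * (e * w) + e * u₂ + e * (e * w)) + (1 * (e * w) + 2 * u₂ + 1 * (e * w))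
                              + (e * (e * w) + e * u₂ + e * (e * w)) + 2 * e * w
                            ≡ 2 * (e + 1) * (e * w + u₂ + e * w)
    polynomial = ℕ-Solver.solve-∀
    identity : ∀ e u₁ u₂ u₃ w → u₁ ≡ e * w → u₃ ≡ e * w →
               (e * u₁ + e * u₂ + e * u₃) + (1 * u₁ + 2 * u₂ + 1 * u₃) + (e * u₁ + e * u₂ + e * u₃) + 2 * e * w
               ≡ 2 * (e + 1) * (u₁ + u₂ + u₃)
    identity e _ u₂ _ w refl refl = polynomial e u₂ w

  ℤ-norm-recurrence : ∀ m → + norm (suc m) ≡
                      (+ 2 Int.* (+ d Int.+ + 1)) Int.* + norm m Int.- (+ 2 Int.* + d) Int.* + previousNorm m
  ℤ-norm-recurrence m = begin
      + N′
    ≡⟨ X≡[X+Y]-Y (+ N′) (+ (2 * d * W)) ⟩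
      + N′ Int.+ + (2 * d * W) Int.- + (2 * d * W)
    ≡⟨ cong (Int._- + (2 * d * W)) (sym (pos-+ N′ (2 * d * W))) ⟩
      + (N′ + 2 * d * W) Int.- + (2 * d * W)
    ≡⟨ cong (λ n → + n Int.- + (2 * d * W)) (norm-recurrence m) ⟩
      + (2 * (d + 1) * N) Int.- + (2 * d * W)
    ≡⟨ cong₂ Int._-_ (trans (pos-* (2 * (d + 1)) N)
                            (cong (Int._* + N) (trans (pos-* 2 (d + 1)) (cong (+ 2 Int.*_) (pos-+ d 1)))))
                     (trans (pos-* (2 * d) W) (cong (Int._* + W) (pos-* 2 d))) ⟩
      (+ 2 Int.* (+ d Int.+ + 1)) Int.* + N Int.- (+ 2 Int.* + d) Int.* + W
    ∎
    where
    open ≡-Reasoning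
    N′ = norm (suc m)
    N = norm m
    W = previousNorm m
    X≡[X+Y]-Y : ∀ X Y → X ≡ X Int.+ Y Int.- Y
    X≡[X+Y]-Y = ℤ-Solver.solve-∀

  c≡norm : ∀ m → cShift (m + d) (suc m) ≡ + norm m
  c≡previousNorm : ∀ m → cShift (m + d ∸ 1) m ≡ + previousNorm m

  c≡norm zero = cong +_ (base d)
    where
    base : ∀ e → 2 * e + 1 ≡ e + 1 + e
    base = ℕ-Solver.solve-∀
  -- cShift unfolds here: (suc m + d) ∸ 1 reduces to m + d and (suc m + d) ∸ 2 to m + d ∸ 1.
  c≡norm (suc m) = begin
      cShift (suc m + d) (suc (suc m))
    ≡⟨ cong₂ (λ c c′ → (+ 2 Int.* (D Int.+ + 1)) Int.* c Int.- (+ 2 Int.* D) Int.* c′)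
             (c≡norm m) (c≡previousNorm m) ⟩
      (+ 2 Int.* (D Int.+ + 1)) Int.* + norm m Int.- (+ 2 Int.* D) Int.* + previousNorm m
    ≡⟨ cong (λ D′ → (+ 2 Int.* (D′ Int.+ + 1)) Int.* + norm m Int.- (+ 2 Int.* D′) Int.* + previousNorm m) D≡d ⟩
      (+ 2 Int.* (+ d Int.+ + 1)) Int.* + norm m Int.- (+ 2 Int.* + d) Int.* + previousNorm m
    ≡⟨ sym (ℤ-norm-recurrence m) ⟩
      + norm (suc m)
    ∎
    where
    open ≡-Reasoning
    D = + (suc m + d) Int.- + suc m
    D≡d : D ≡ + d
    D≡d = trans ([+m]-[+n]≡m⊖n (suc m + d) (suc m)) (trans (⊖-≥ (m≤m+n (suc m) d)) (cong +_ (m+n∸m≡n (suc m) d)))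

  c≡previousNorm zero = refl
  c≡previousNorm (suc m) = c≡norm m

classification⇒classCount : ∀ {k m N} → Classification k (HasIota m) (Fin N) → ClassCount k m N
classification⇒classCount C =
  rep , HasIota⇒Iota ∘ rep-sound , rep-injective , λ w ι → rep-complete (Iota⇒HasIota ι)
  where open Classification C

<⇒≡+suc : ∀ {m k} → m < k → ∃[ d₀ ] (k ≡ m + suc d₀)
<⇒≡+suc {m} {k} m<k = k ∸ suc m , sym (trans (+-suc m (k ∸ suc m)) (m+[n∸m]≡n m<k))

matrixValue-+ : ∀ m d₀ → matrixValue (m + suc d₀) m ≡ norm1 (Construction.counts d₀ m)
matrixValue-+ m d₀ =
  cong (λ d → norm1 (pow· (mat ⟨ d , d , d ⟩ ⟨ 1 , 2 , 1 ⟩ ⟨ d , d , d ⟩) m ⟨ d , 1 , d ⟩))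
       (m+n∸m≡n m (suc d₀))

theorem4 : ∀ (k m : ℕ) → m < k →
    ClassCount k m (matrixValue k m) × (+ (matrixValue k m) ≡ c k m)
theorem4 k m m<k with <⇒≡+suc m<k
... | d₀ , refl =
  subst (λ N → ClassCount (m + d) m N × (+ N ≡ c (m + d) m)) (sym (matrixValue-+ m d₀))
        (classification⇒classCount (classification m) , sym (c≡norm m))
  where open Construction d₀
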